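{- Let $k\ge 6$ be an integer and let $G$ be a graph with $ch_3^d(G)>k$ having the smallest number of vertices and edges among all graphs with list 3-dynamic chromatic number greater than $k$. Then: (1) $G$ has no vertex of degree at most $1$; (2) no two vertices of degree at most $2$ are adjacent in $G$; (3) no two adjacent vertices of $G$ have a common neighbor of degree $2$; (4) for each $i\in\{1,2,3\}$, every vertex in $W_i(G)$ has $i$ distinct weak neighbors.
   Context: A 3-dynamic coloring of a graph $G$ is a proper vertex coloring such that every vertex $v$ sees at least $\min\{3,\deg_G(v)\}$ distinct colors in $N_G(v)$. $ch_3^d(G)$ is the least $k$ such that for every list assignment $L$ with $|L(v)|\ge k$ for all $v$, $G$ has a 3-dynamic coloring $\phi$ with $\phi(v)\in L(v)$ for all $v$. A $d$-vertex is a vertex of degree $d$; a $d$-neighbor of $x$ is a neighbor of $x$ of degree $d$. Two vertices $x,y$ are weakly adjacent (and $y$ is a weak neighbor of $x$) if they have a common neighbor of degree 2. For $i\in\{0,1,2,3\}$, $W_i(G)$ is the set of vertices of degree $3$ having exactly $i$ neighbors of degree $2$. -}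

module Defs where

open import Data.Nat using (ℕ; _≤_; _<_; _+_; _⊓_; _≡ᵇ_; _<ᵇ_)
open import Data.Bool using (Bool; true; false; _∧_)
open import Data.Fin using (Fin; toℕ)
open import Data.List using (List; length; filter; map; allFin; deduplicate; cartesianProduct)
open import Data.List.Membership.Propositional using (_∈_)
open import Data.List.Relation.Unary.Unique.Propositional using (Unique)
open import Data.Product using (Σ; _×_; proj₁; proj₂)
open import Relation.Binary.PropositionalEquality using (_≡_; _≢_)
open import Relation.Nullary.Decidable using (T?)
open import Data.Nat.Properties using (_≟_)
open import Function using (_∘_)

record Graph : Set where
  field
    n      : ℕ
    adj    : Fin n → Fin n → Bool
    sym    : ∀ u v → adj u v ≡ adj v u
    irrefl : ∀ v → adj v v ≡ false
open Graph public

module _ (G : Graph) where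

  nbrs : Fin (n G) → List (Fin (n G))
  nbrs v = filter (λ u → T? (adj G v u)) (allFin (n G))

  deg : Fin (n G) → ℕ
  deg v = length (nbrs v)

  numEdges : ℕ
  numEdges = length (filter (λ p → T? ((toℕ (proj₁ p) <ᵇ toℕ (proj₂ p)) ∧ adj G (proj₁ p) (proj₂ p)))
                            (cartesianProduct (allFin (n G)) (allFin (n G))))

  size : ℕ
  size = n G + numEdges

  seenColours : (Fin (n G) → ℕ) → Fin (n G) → ℕ
  seenColours φ v = length (deduplicate _≟_ (map φ (nbrs v)))

  Is3Dynamic : (Fin (n G) → ℕ) → Set
  Is3Dynamic φ = (∀ u v → adj G u v ≡ true → φ u ≢ φ v)
               × (∀ v → 3 ⊓ deg v ≤ seenColours φ v)

  ListAssignment : ℕ → Set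
  ListAssignment k = Σ (Fin (n G) → List ℕ) λ L → ∀ v → Unique (L v) × k ≤ length (L v)

  Choosable3d : ℕ → Set
  Choosable3d k = (L : ListAssignment k) →
    Σ (Fin (n G) → ℕ) λ φ → Is3Dynamic φ × (∀ v → φ v ∈ proj₁ L v)

  WeakAdj : Fin (n G) → Fin (n G) → Set
  WeakAdj x y = x ≢ y × Σ (Fin (n G)) λ w → adj G x w ≡ true × adj G y w ≡ true × deg w ≡ 2

  num2Nbrs : Fin (n G) → ℕ
  num2Nbrs v = length (filter (λ u → deg u ≟ 2) (nbrs v))

  InW : ℕ → Fin (n G) → Set
  InW i v = deg v ≡ 3 × num2Nbrs v ≡ i

-- In each of (1)-(4) there is
-- a vertex x of degree at most 2 (or an isolated vertex, which is simply deleted) such that a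
-- 3-dynamic L-colouring ψ of G with the edges at x removed, given by minimality, extends to G.
-- The colour of x must differ from ψ on N(x) and, for every neighbour y that sees at most two
-- colours, from the colours y sees; and N(x) must already carry min{3, deg x} colours. In every
-- configuration these conditions exclude at most five colours, so |L(x)| ≥ 6 leaves a choice.
-- For (4), the far ends of the 2-neighbours of a 3-vertex v are distinct: two 2-vertices joining
-- v to the same vertex y form such a configuration.

module Submission where

open import Defs
open import Data.Bool using (Bool; true; false; _∧_; not)
open import Data.Bool.Properties using (∧-comm; T-≡; T-∧)
open import Data.Empty using (⊥)
open import Data.Fin as Fin using (Fin; toℕ; punchIn; punchOut)
import Data.Fin.Properties as Finₚ
open import Data.List using (List; []; _∷_; length; filter; map; allFin; deduplicate; cartesianProduct; _++_; lookup)
open import Data.List.Properties using (length-map; length-++; length-filter; filter-notAll; length-deduplicate)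
open import Data.List.Membership.Propositional using (_∈_; _∉_; find; lose)
open import Data.List.Membership.Propositional.Properties
open import Data.List.Relation.Binary.Subset.Propositional using (_⊆_)
open import Data.List.Relation.Unary.All as All using (All; []; _∷_)
open import Data.List.Relation.Unary.All.Properties using (¬Any⇒All¬)
open import Data.List.Relation.Unary.Any using (here; there; any?)
open import Data.List.Relation.Unary.AllPairs using ([]; _∷_)
open import Data.List.Relation.Unary.Unique.Propositional using (Unique)
import Data.List.Relation.Unary.Unique.Propositional.Properties as Uniqueₚ
open import Data.Nat as ℕ using (ℕ; zero; suc; _+_; _⊓_; _≤_; _<_; _≤?_; z≤n; s≤s; _<ᵇ_)
open import Data.Nat.Properties
open import Data.List.Relation.Unary.Unique.DecPropositional.Properties ℕ._≟_ using (deduplicate-!)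
open import Data.Product using (Σ; ∃; _×_; _,_; proj₁; proj₂)
open import Data.Sum using (_⊎_; inj₁; inj₂)
open import Data.Vec.Functional using (updateAt; insertAt)
open import Data.Vec.Functional.Properties using (updateAt-updates; updateAt-minimal)
open import Function using (_∘_; _$_; const)
open import Function.Bundles using (Equivalence)
open import Function.Definitions using (Injective)
open import Relation.Binary.Definitions using (DecidableEquality; tri<; tri≈; tri>)
open import Relation.Binary.PropositionalEquality as ≡ using (_≡_; _≢_; refl; trans; cong; cong₂; subst)
open import Relation.Nullary using (¬_; Dec; yes; no; contradiction)
open import Relation.Nullary.Decidable using (T?; ⌊_⌋; ¬?; decidable-stable)

length-++-≤ : ∀ {A : Set} (xs : List A) {ys a b} → length xs ≤ a → length ys ≤ b → length (xs ++ ys) ≤ a + b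
length-++-≤ xs |xs|≤a |ys|≤b = ≤-trans (≤-reflexive (length-++ xs)) (+-mono-≤ |xs|≤a |ys|≤b)

insertAt-updates : ∀ {A : Set} {m} (ψ : Fin m → A) x c → insertAt ψ x c x ≡ c
insertAt-updates ψ Fin.zero c = refl
insertAt-updates {m = suc _} ψ (Fin.suc x) c = insertAt-updates (ψ ∘ Fin.suc) x c

insertAt-punchIn : ∀ {A : Set} {m} (ψ : Fin m → A) x c u → insertAt ψ x c (punchIn x u) ≡ ψ u
insertAt-punchIn ψ Fin.zero c u = refl
insertAt-punchIn {m = suc _} ψ (Fin.suc x) c Fin.zero = refl
insertAt-punchIn {m = suc _} ψ (Fin.suc x) c (Fin.suc u) = insertAt-punchIn (ψ ∘ Fin.suc) x c u

module _ {A : Set} where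

  private
    remove : ∀ {x : A} {ys} → x ∈ ys →
             Σ (List A) λ zs → suc (length zs) ≡ length ys × (∀ {z} → z ∈ ys → z ≢ x → z ∈ zs)
    remove {ys = y ∷ ys} (here refl) = ys , refl , λ { (here refl) z≢y → contradiction refl z≢y ; (there z∈) _ → z∈ }
    remove {ys = y ∷ ys} (there x∈ys) with zs , eq , ys-x⊆zs ← remove x∈ys
      = y ∷ zs , cong suc eq , λ { (here refl) _ → here refl ; (there z∈) z≢x → there (ys-x⊆zs z∈ z≢x) }

  Unique-⊆⇒length≤ : ∀ {xs ys : List A} → Unique xs → xs ⊆ ys → length xs ≤ length ys
  Unique-⊆⇒length≤ {[]} _ _ = z≤n
  Unique-⊆⇒length≤ {x ∷ xs} (x∉xs ∷ xs!) xs⊆ys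
    with zs , 1+|zs|≡|ys| , ys-x⊆zs ← remove (xs⊆ys (here refl))
    = subst (suc (length xs) ≤_) 1+|zs|≡|ys|
        (s≤s (Unique-⊆⇒length≤ xs! (λ z∈xs → ys-x⊆zs (xs⊆ys (there z∈xs)) (All.lookup x∉xs z∈xs ∘ ≡.sym))))

  Unique-⊂⇒length< : ∀ {xs ys : List A} {y} → Unique xs → xs ⊆ ys → y ∈ ys → y ∉ xs → length xs < length ys
  Unique-⊂⇒length< {xs} xs! xs⊆ys y∈ys y∉xs =
    Unique-⊆⇒length≤ (¬Any⇒All¬ xs y∉xs ∷ xs!) λ { (here refl) → y∈ys ; (there z∈xs) → xs⊆ys z∈xs }

  lookup-injective : ∀ {xs : List A} → Unique xs → Injective _≡_ _≡_ (lookup xs)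
  lookup-injective {_ ∷ _} _ {Fin.zero} {Fin.zero} _ = refl
  lookup-injective {_ ∷ _} (x∉xs ∷ _) {Fin.zero} {Fin.suc j} eq =
    contradiction eq (All.lookup x∉xs (∈-lookup j))
  lookup-injective {_ ∷ _} (x∉xs ∷ _) {Fin.suc i} {Fin.zero} eq =
    contradiction (≡.sym eq) (All.lookup x∉xs (∈-lookup i))
  lookup-injective {_ ∷ _} (_ ∷ xs!) {Fin.suc i} {Fin.suc j} eq = cong Fin.suc (lookup-injective xs! eq)

module _ {A : Set} (_≟_ : DecidableEquality A) where
  open import Data.List.Membership.DecPropositional _≟_ using (_∈?_)

  longer⇒∃∉ : ∀ {xs ys : List A} → Unique xs → length ys < length xs → ∃ λ x → x ∈ xs × x ∉ ys
  longer⇒∃∉ {xs} {ys} xs! |ys|<|xs| with any? (λ x → ¬? (x ∈? ys)) xs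
  ... | yes ∃x∉ys = find ∃x∉ys
  ... | no ∄x∉ys = contradiction (Unique-⊆⇒length≤ xs! xs⊆ys) (<⇒≱ |ys|<|xs|)
    where
    xs⊆ys : xs ⊆ ys
    xs⊆ys {x} x∈xs = decidable-stable (x ∈? ys) (∄x∉ys ∘ lose x∈xs)

  ∃≢⊎All≡ : ∀ v xs → (∃ λ x → x ∈ xs × x ≢ v) ⊎ All (_≡ v) xs
  ∃≢⊎All≡ v xs with any? (λ x → ¬? (x ≟ v)) xs
  ... | yes ∃x≢v = inj₁ (find ∃x≢v)
  ... | no ∄x≢v = inj₂ (All.map (decidable-stable (_ ≟ v)) (¬Any⇒All¬ xs ∄x≢v))

module _ (G : Graph) where

  adj-sym : ∀ {u v} → adj G u v ≡ true → adj G v u ≡ true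
  adj-sym {u} {v} = trans (sym G v u)

  adj⇒≢ : ∀ {u v} → adj G u v ≡ true → u ≢ v
  adj⇒≢ {u} uv refl = contradiction (trans (≡.sym (irrefl G u)) uv) λ ()

  ∈nbrs⁺ : ∀ {v y} → adj G v y ≡ true → y ∈ nbrs G v
  ∈nbrs⁺ {v} {y} vy = ∈-filter⁺ (λ u → T? (adj G v u)) (∈-allFin y) (Equivalence.from T-≡ vy)

  ∈nbrs⁻ : ∀ {v y} → y ∈ nbrs G v → adj G v y ≡ true
  ∈nbrs⁻ {v} y∈ = Equivalence.to T-≡ (proj₂ (∈-filter⁻ (λ u → T? (adj G v u)) {xs = allFin (n G)} y∈))

  nbrs-unique : ∀ v → Unique (nbrs G v)
  nbrs-unique v = Uniqueₚ.filter⁺ (λ u → T? (adj G v u)) (Uniqueₚ.allFin⁺ (n G))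

  length≤deg : ∀ {v ys} → Unique ys → (∀ {y} → y ∈ ys → adj G v y ≡ true) → length ys ≤ deg G v
  length≤deg ys! ys⊆N = Unique-⊆⇒length≤ ys! (∈nbrs⁺ ∘ ys⊆N)

  deg≤length : ∀ {v} ys → (∀ {y} → adj G v y ≡ true → y ∈ ys) → deg G v ≤ length ys
  deg≤length ys N⊆ys = Unique-⊆⇒length≤ (nbrs-unique _) (N⊆ys ∘ ∈nbrs⁻)

  nbr-other-than : ∀ u v → (∃ λ a → adj G u a ≡ true × a ≢ v) ⊎ (∀ {a} → adj G u a ≡ true → a ≡ v)
  nbr-other-than u v with ∃≢⊎All≡ Fin._≟_ v (nbrs G u)
  ... | inj₁ (a , a∈ , a≢v) = inj₁ (a , ∈nbrs⁻ a∈ , a≢v)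
  ... | inj₂ all≡v = inj₂ (All.lookup all≡v ∘ ∈nbrs⁺)

  Isolated : Fin (n G) → Set
  Isolated x = ∀ y → adj G x y ≢ true

  isolated⊎nbr : ∀ x → Isolated x ⊎ ∃ λ y → adj G x y ≡ true
  isolated⊎nbr x with nbr-other-than x x
  ... | inj₁ (y , xy , _) = inj₂ (y , xy)
  ... | inj₂ nbrs≡x = inj₁ λ y xy → adj⇒≢ xy (≡.sym (nbrs≡x xy))

  nbr-of-deg≤1 : ∀ {w a z} → deg G w ≤ 1 → adj G w a ≡ true → adj G w z ≡ true → z ≡ a
  nbr-of-deg≤1 {w} {a} {z} w≤1 wa wz = decidable-stable (z Fin.≟ a) λ z≢a →
    <⇒≱ (length≤deg ((z≢a ∘ ≡.sym ∷ []) ∷ [] ∷ []) λ { (here refl) → wa ; (there (here refl)) → wz }) w≤1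

  nbrs-of-deg≤2 : ∀ {w a b z} → deg G w ≤ 2 → adj G w a ≡ true → adj G w b ≡ true → a ≢ b →
                  adj G w z ≡ true → z ≡ a ⊎ z ≡ b
  nbrs-of-deg≤2 {w} {a} {b} {z} w≤2 wa wb a≢b wz with z Fin.≟ a | z Fin.≟ b
  ... | yes z≡a | _ = inj₁ z≡a
  ... | no _ | yes z≡b = inj₂ z≡b
  ... | no z≢a | no z≢b = contradiction w≤2 (<⇒≱ (length≤deg ((a≢b ∷ z≢a ∘ ≡.sym ∷ []) ∷ (z≢b ∘ ≡.sym ∷ []) ∷ [] ∷ [])
        λ { (here refl) → wa ; (there (here refl)) → wb ; (there (there (here refl))) → wz }))

  other-nbr-of-deg2 : ∀ {w} v → deg G w ≡ 2 → ∃ λ y → adj G w y ≡ true × y ≢ v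
  other-nbr-of-deg2 {w} v w≡2 with nbr-other-than w v
  ... | inj₁ other = other
  ... | inj₂ nbrs≡v = contradiction (deg≤length (v ∷ []) (here ∘ nbrs≡v)) (<⇒≱ (≤-reflexive (≡.sym w≡2)))

  seen : (Fin (n G) → ℕ) → Fin (n G) → List ℕ
  seen φ v = deduplicate ℕ._≟_ (map φ (nbrs G v))

  seen-unique : ∀ φ v → Unique (seen φ v)
  seen-unique φ v = deduplicate-! (map φ (nbrs G v))

  ∈seen⁺ : ∀ φ {v y} → adj G v y ≡ true → φ y ∈ seen φ v
  ∈seen⁺ φ vy = ∈-deduplicate⁺ ℕ._≟_ (∈-map⁺ φ (∈nbrs⁺ vy))

  ∈seen⁻ : ∀ φ {v c} → c ∈ seen φ v → ∃ λ y → adj G v y ≡ true × c ≡ φ y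
  ∈seen⁻ φ {v} c∈ with y , y∈ , c≡φy ← ∈-map⁻ φ (∈-deduplicate⁻ ℕ._≟_ (map φ (nbrs G v)) c∈)
    = y , ∈nbrs⁻ y∈ , c≡φy

  seenColours≤deg : ∀ φ v → seenColours G φ v ≤ deg G v
  seenColours≤deg φ v = ≤-trans (length-deduplicate ℕ._≟_ (map φ (nbrs G v))) (≤-reflexive (length-map φ (nbrs G v)))

  DynamicAt : (Fin (n G) → ℕ) → Fin (n G) → Set
  DynamicAt φ v = 3 ⊓ deg G v ≤ seenColours G φ v

  dynamicAt-isolated : ∀ {φ v} → Isolated v → DynamicAt φ v
  dynamicAt-isolated {v = v} iso =
    ≤-trans (m⊓n≤n 3 (deg G v)) (≤-trans (deg≤length [] λ {y} vy → contradiction vy (iso y)) z≤n)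

  dynamicAt-deg≤1 : ∀ {φ v y} → deg G v ≤ 1 → adj G v y ≡ true → DynamicAt φ v
  dynamicAt-deg≤1 {φ} {v} v≤1 vy = ≤-trans (m⊓n≤n 3 (deg G v))
    (≤-trans v≤1 (Unique-⊆⇒length≤ ([] ∷ []) λ { (here refl) → ∈seen⁺ φ vy }))

  dynamicAt-deg≤2 : ∀ {φ v a b} → deg G v ≤ 2 → adj G v a ≡ true → adj G v b ≡ true → φ a ≢ φ b → DynamicAt φ v
  dynamicAt-deg≤2 {φ} {v} v≤2 va vb φa≢φb = ≤-trans (m⊓n≤n 3 (deg G v))
    (≤-trans v≤2 (Unique-⊆⇒length≤ ((φa≢φb ∷ []) ∷ [] ∷ [])
      λ { (here refl) → ∈seen⁺ φ va ; (there (here refl)) → ∈seen⁺ φ vb }))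

  dynamicAt⇒nbrs-distinct : ∀ {φ w a b} → DynamicAt φ w → deg G w ≤ 2 → adj G w a ≡ true → adj G w b ≡ true →
                            a ≢ b → φ a ≢ φ b
  dynamicAt⇒nbrs-distinct {φ} {w} {a} w-dynamic w≤2 wa wb a≢b φa≡φb = <⇒≱ (begin-strict
    1                     <⟨ s≤s (s≤s z≤n) ⟩
    3 ⊓ 2                 ≤⟨ ⊓-monoʳ-≤ 3 (length≤deg ((a≢b ∷ []) ∷ [] ∷ [])
                                  λ { (here refl) → wa ; (there (here refl)) → wb }) ⟩
    3 ⊓ deg G w           ≤⟨ w-dynamic ⟩
    seenColours G φ w     ∎) (Unique-⊆⇒length≤ (seen-unique φ w) seen⊆[φa])
    where
    open ≤-Reasoning
    seen⊆[φa] : seen φ w ⊆ φ a ∷ []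
    seen⊆[φa] c∈ with z , wz , refl ← ∈seen⁻ φ c∈ with nbrs-of-deg≤2 w≤2 wa wb a≢b wz
    ... | inj₁ refl = here refl
    ... | inj₂ refl = here (≡.sym φa≡φb)

  DynamicLColouring : (Fin (n G) → List ℕ) → (Fin (n G) → ℕ) → Set
  DynamicLColouring L φ = Is3Dynamic G φ × (∀ v → φ v ∈ L v)

  edgePairs : List (Fin (n G) × Fin (n G))
  edgePairs = filter (λ p → T? ((toℕ (proj₁ p) <ᵇ toℕ (proj₂ p)) ∧ adj G (proj₁ p) (proj₂ p)))
                     (cartesianProduct (allFin (n G)) (allFin (n G)))

  edgePairs-unique : Unique edgePairs
  edgePairs-unique = Uniqueₚ.filter⁺ _ (Uniqueₚ.cartesianProduct⁺ (Uniqueₚ.allFin⁺ (n G)) (Uniqueₚ.allFin⁺ (n G)))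

  ∈edgePairs⁺ : ∀ {u v} → toℕ u < toℕ v → adj G u v ≡ true → (u , v) ∈ edgePairs
  ∈edgePairs⁺ {u} {v} u<v uv = ∈-filter⁺ _ (∈-cartesianProduct⁺ (∈-allFin u) (∈-allFin v))
    (Equivalence.from T-∧ (<⇒<ᵇ u<v , Equivalence.from T-≡ uv))

  ∈edgePairs⁻ : ∀ {u v} → (u , v) ∈ edgePairs → toℕ u < toℕ v × adj G u v ≡ true
  ∈edgePairs⁻ {u} {v} uv∈
    with u<ᵇv , uv ← Equivalence.to T-∧ (proj₂ (∈-filter⁻ _ {xs = cartesianProduct (allFin (n G)) (allFin (n G))} uv∈))
    = <ᵇ⇒< (toℕ u) (toℕ v) u<ᵇv , Equivalence.to T-≡ uv

-- x is kept as an isolated vertex, so colourings of G and of detach G x have the same type.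
detach : (G : Graph) → Fin (n G) → Graph
detach G x = record
  { n      = n G
  ; adj    = λ u v → adj G u v ∧ (not ⌊ u Fin.≟ x ⌋ ∧ not ⌊ v Fin.≟ x ⌋)
  ; sym    = λ u v → cong₂ _∧_ (sym G u v) (∧-comm (not ⌊ u Fin.≟ x ⌋) _)
  ; irrefl = λ v → cong (_∧ _) (irrefl G v)
  }

module _ (G : Graph) (x : Fin (n G)) where

  detach-adj⁻ : ∀ {u v} → adj (detach G x) u v ≡ true → adj G u v ≡ true × u ≢ x × v ≢ x
  detach-adj⁻ {u} {v} uv with u Fin.≟ x | v Fin.≟ x | adj G u v
  ... | no u≢x | no v≢x | true = refl , u≢x , v≢x
  ... | yes _  | _      | true = contradiction uv λ ()
  ... | no _   | yes _  | true = contradiction uv λ ()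
  ... | _      | _      | false = contradiction uv λ ()

  detach-adj⁺ : ∀ {u v} → adj G u v ≡ true → u ≢ x → v ≢ x → adj (detach G x) u v ≡ true
  detach-adj⁺ {u} {v} uv u≢x v≢x with u Fin.≟ x | v Fin.≟ x
  ... | yes u≡x | _       = contradiction u≡x u≢x
  ... | no _    | yes v≡x = contradiction v≡x v≢x
  ... | no _    | no _    rewrite uv = refl

  detach-edgePairs⊆ : edgePairs (detach G x) ⊆ edgePairs G
  detach-edgePairs⊆ {u , v} uv∈ with u<v , uv ← ∈edgePairs⁻ (detach G x) uv∈
    = ∈edgePairs⁺ G u<v (proj₁ (detach-adj⁻ uv))

  size-detach≤ : size (detach G x) ≤ size G
  size-detach≤ = +-monoʳ-≤ (n G) (Unique-⊆⇒length≤ (edgePairs-unique (detach G x)) detach-edgePairs⊆)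

  private
    size-detach<-by : ∀ {p} → p ∈ edgePairs G → p ∉ edgePairs (detach G x) → size (detach G x) < size G
    size-detach<-by p∈ p∉ = +-monoʳ-< (n G) (Unique-⊂⇒length< (edgePairs-unique (detach G x)) detach-edgePairs⊆ p∈ p∉)

  size-detach< : ∀ {y} → adj G x y ≡ true → size (detach G x) < size G
  size-detach< {y} xy with <-cmp (toℕ x) (toℕ y)
  ... | tri< x<y _ _ = size-detach<-by (∈edgePairs⁺ G x<y xy)
                         λ xy∈ → proj₁ (proj₂ (detach-adj⁻ (proj₂ (∈edgePairs⁻ (detach G x) xy∈)))) refl
  ... | tri≈ _ x≡y _ = contradiction (Finₚ.toℕ-injective x≡y) (adj⇒≢ G xy)
  ... | tri> _ _ y<x = size-detach<-by (∈edgePairs⁺ G y<x (adj-sym G xy))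
                         λ yx∈ → proj₂ (proj₂ (detach-adj⁻ (proj₂ (∈edgePairs⁻ (detach G x) yx∈)))) refl

  deg-detach≤ : ∀ {y} → deg (detach G x) y ≤ deg G y
  deg-detach≤ = length≤deg G (nbrs-unique (detach G x) _) (proj₁ ∘ detach-adj⁻ ∘ ∈nbrs⁻ (detach G x))

  deg-detach< : ∀ {y} → adj G y x ≡ true → deg (detach G x) y < deg G y
  deg-detach< {y} yx = length≤deg G (¬Any⇒All¬ _ x∉ ∷ nbrs-unique (detach G x) y)
    λ { (here refl) → yx ; (there z∈) → proj₁ (detach-adj⁻ (∈nbrs⁻ (detach G x) z∈)) }
    where
    x∉ : x ∉ nbrs (detach G x) y
    x∉ x∈ = proj₂ (proj₂ (detach-adj⁻ (∈nbrs⁻ (detach G x) x∈))) refl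

  deg≤1+deg-detach : ∀ {y} → y ≢ x → deg G y ≤ suc (deg (detach G x) y)
  deg≤1+deg-detach {y} y≢x = deg≤length G (x ∷ nbrs (detach G x) y) λ {z} → nbr∈ (z Fin.≟ x)
    where
    nbr∈ : ∀ {z} → Dec (z ≡ x) → adj G y z ≡ true → z ∈ x ∷ nbrs (detach G x) y
    nbr∈ (yes refl) _ = here refl
    nbr∈ (no z≢x) yz = there (∈nbrs⁺ (detach G x) (detach-adj⁺ yz y≢x z≢x))

  deg≤deg-detach : ∀ {y} → y ≢ x → adj G y x ≢ true → deg G y ≤ deg (detach G x) y
  deg≤deg-detach {y} y≢x ¬yx = deg≤length G (nbrs (detach G x) y) λ {z} yz →
    ∈nbrs⁺ (detach G x) (detach-adj⁺ yz y≢x λ { refl → ¬yx yz })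

_[_]≔_ : ∀ {m} → (Fin m → ℕ) → Fin m → ℕ → Fin m → ℕ
ψ [ x ]≔ c = updateAt ψ x (const c)

module _ (G : Graph) (x : Fin (n G)) {ψ : Fin (n G) → ℕ} {c : ℕ} where

  seen-detach⊆ : ∀ {y} → seen (detach G x) ψ y ⊆ seen G (ψ [ x ]≔ c) y
  seen-detach⊆ {y} c′∈ with z , yz , refl ← ∈seen⁻ (detach G x) ψ c′∈
                   with yzG , _ , z≢x ← detach-adj⁻ G x yz
    = subst (_∈ seen G (ψ [ x ]≔ c) y) (updateAt-minimal z x ψ z≢x) (∈seen⁺ G (ψ [ x ]≔ c) yzG)

  seen-recolour⊆ : seen G ψ x ⊆ seen G (ψ [ x ]≔ c) x
  seen-recolour⊆ c′∈ with z , xz , refl ← ∈seen⁻ G ψ c′∈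
    = subst (_∈ seen G (ψ [ x ]≔ c) x) (updateAt-minimal z x ψ (adj⇒≢ G xz ∘ ≡.sym)) (∈seen⁺ G (ψ [ x ]≔ c) xz)

  seenColours-detach≤ : ∀ {y} → seenColours (detach G x) ψ y ≤ seenColours G (ψ [ x ]≔ c) y
  seenColours-detach≤ {y} = Unique-⊆⇒length≤ (seen-unique (detach G x) ψ y) seen-detach⊆

  seenColours-detach< : ∀ {y} → adj G y x ≡ true → c ∉ seen (detach G x) ψ y →
                        seenColours (detach G x) ψ y < seenColours G (ψ [ x ]≔ c) y
  seenColours-detach< {y} yx c∉ = Unique-⊆⇒length≤ (¬Any⇒All¬ _ c∉ ∷ seen-unique (detach G x) ψ y) λ
    { (here refl) → subst (_∈ seen G (ψ [ x ]≔ c) y) (updateAt-updates x ψ) (∈seen⁺ G (ψ [ x ]≔ c) yx)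
    ; (there c′∈) → seen-detach⊆ c′∈ }

recolour-∈ : ∀ {m} {L : Fin m → List ℕ} {ψ x c} → (∀ v → ψ v ∈ L v) → c ∈ L x → ∀ v → (ψ [ x ]≔ c) v ∈ L v
recolour-∈ {L = L} {ψ} {x} ψ∈L c∈Lx v with v Fin.≟ x
... | yes refl = subst (_∈ L x) (≡.sym (updateAt-updates x ψ)) c∈Lx
... | no v≢x = subst (_∈ L v) (≡.sym (updateAt-minimal v x ψ v≢x)) (ψ∈L v)

module _ (H : Graph) (ψ : Fin (n H) → ℕ) where

  Admissible : Fin (n H) → ℕ → Set
  Admissible y c = c ≢ ψ y × (seenColours H ψ y ≤ 2 → c ∉ seen H ψ y)

  forbidden : Fin (n H) → List ℕ
  forbidden y with seenColours H ψ y ≤? 2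
  ... | yes _ = ψ y ∷ seen H ψ y
  ... | no _ = ψ y ∷ []

  ∉forbidden⇒admissible : ∀ {y c} → c ∉ forbidden y → Admissible y c
  ∉forbidden⇒admissible {y} c∉ with seenColours H ψ y ≤? 2
  ... | yes _ = c∉ ∘ here , λ _ → c∉ ∘ there
  ... | no many = c∉ ∘ here , λ few → contradiction few many

  length-forbidden≤3 : ∀ y → length (forbidden y) ≤ 3
  length-forbidden≤3 y with seenColours H ψ y ≤? 2
  ... | yes few = s≤s few
  ... | no _ = s≤s z≤n

  length-forbidden≤1+deg : ∀ y → length (forbidden y) ≤ suc (deg H y)
  length-forbidden≤1+deg y with seenColours H ψ y ≤? 2
  ... | yes _ = s≤s (seenColours≤deg H ψ y)
  ... | no _ = s≤s z≤n

  ∈forbidden⁺ : ∀ {y z} → seenColours H ψ y ≤ 2 → adj H y z ≡ true → ψ z ∈ forbidden y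
  ∈forbidden⁺ {y} few yz with seenColours H ψ y ≤? 2
  ... | yes _ = there (∈seen⁺ H ψ yz)
  ... | no many = contradiction few many

  private
    ≢? : ∀ d c → Dec (c ≢ d)
    ≢? d c = ¬? (c ℕ.≟ d)

  forbidden-without : Fin (n H) → ℕ → List ℕ
  forbidden-without y d = filter (≢? d) (forbidden y)

  ∉forbidden-without : ∀ {y c d} → c ∉ forbidden-without y d → c ≢ d → c ∉ forbidden y
  ∉forbidden-without c∉ c≢d c∈ = c∉ (∈-filter⁺ (≢? _) c∈ c≢d)

  length-forbidden-without≤2 : ∀ {y z} → adj H y z ≡ true → length (forbidden-without y (ψ z)) ≤ 2
  length-forbidden-without≤2 {y} {z} yz with seenColours H ψ y ≤? 2
  ... | yes few = ≤-pred (≤-trans (filter-notAll (≢? (ψ z)) (ψ y ∷ seen H ψ y) (there (lose (∈seen⁺ H ψ yz) (_$ refl))))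
                                  (s≤s few))
  ... | no _ = ≤-trans (length-filter (≢? (ψ z)) (ψ y ∷ [])) (s≤s z≤n)

  -- avoid p q always contains ψ q, and it contains the colours seen by p when there are at most two;
  -- so for adjacent p, q two lists of length 2 cover the conditions at both.
  avoid : Fin (n H) → Fin (n H) → List ℕ
  avoid p q with seenColours H ψ p ≤? 2
  ... | yes _ = seen H ψ p
  ... | no _ = ψ q ∷ []

  length-avoid≤2 : ∀ p q → length (avoid p q) ≤ 2
  length-avoid≤2 p q with seenColours H ψ p ≤? 2
  ... | yes few = few
  ... | no _ = s≤s z≤n

  ∉avoid⇒admissible : ∀ {p q c} → adj H p q ≡ true → c ∉ avoid p q → c ∉ avoid q p → Admissible p c
  ∉avoid⇒admissible {p} {q} {c} pq c∉pq c∉qp = c≢ψp , c-fresh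
    where
    c≢ψp : c ≢ ψ p
    c≢ψp refl with seenColours H ψ q ≤? 2
    ... | yes _ = c∉qp (∈seen⁺ H ψ (adj-sym H pq))
    ... | no _ = c∉qp (here refl)
    c-fresh : seenColours H ψ p ≤ 2 → c ∉ seen H ψ p
    c-fresh few c∈ with seenColours H ψ p ≤? 2
    ... | yes _ = c∉pq c∈
    ... | no many = many few

module _ (G : Graph) (x : Fin (n G)) {ψ : Fin (n G) → ℕ} {c : ℕ} where

  extend : Is3Dynamic (detach G x) ψ → (∀ {y} → adj G x y ≡ true → Admissible (detach G x) ψ y c) →
           DynamicAt G ψ x → Is3Dynamic G (ψ [ x ]≔ c)
  extend (ψ-proper , ψ-dynamic) admissible x-dynamic = φ-proper , φ-dynamic
    where
    H = detach G x
    φ = ψ [ x ]≔ c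
    φx≡c : φ x ≡ c
    φx≡c = updateAt-updates x ψ
    φ≡ψ : ∀ {y} → y ≢ x → φ y ≡ ψ y
    φ≡ψ {y} = updateAt-minimal y x ψ

    φ-proper : ∀ u v → adj G u v ≡ true → φ u ≢ φ v
    φ-proper u v uv with u Fin.≟ x | v Fin.≟ x
    ... | yes refl | yes refl = contradiction refl (adj⇒≢ G uv)
    ... | yes refl | no v≢x = λ φx≡φv →
      proj₁ (admissible uv) (trans (≡.sym φx≡c) (trans φx≡φv (φ≡ψ v≢x)))
    ... | no u≢x | yes refl = λ φu≡φx →
      proj₁ (admissible (adj-sym G uv)) (trans (≡.sym φx≡c) (trans (≡.sym φu≡φx) (φ≡ψ u≢x)))
    ... | no u≢x | no v≢x = λ φu≡φv →
      ψ-proper u v (detach-adj⁺ G x uv u≢x v≢x) (trans (≡.sym (φ≡ψ u≢x)) (trans φu≡φv (φ≡ψ v≢x)))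

    φ-dynamic : ∀ v → DynamicAt G φ v
    φ-dynamic v with v Fin.≟ x
    ... | yes refl = ≤-trans x-dynamic (Unique-⊆⇒length≤ (seen-unique G ψ x) (seen-recolour⊆ G x))
    ... | no v≢x with adj G v x in vx
    ...   | false = ≤-trans (⊓-monoʳ-≤ 3 (deg≤deg-detach G x v≢x λ vx′ → contradiction (trans (≡.sym vx) vx′) λ ()))
                            (≤-trans (ψ-dynamic v) (seenColours-detach≤ G x))
    ...   | true with seenColours H ψ v ≤? 2
    ...     | no many = ≤-trans (m⊓n≤m 3 (deg G v)) (≤-trans (≰⇒> many) (seenColours-detach≤ G x))
    ...     | yes few = begin
      3 ⊓ deg G v              ≤⟨ ⊓-monoʳ-≤ 3 (deg≤1+deg-detach G x v≢x) ⟩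
      3 ⊓ suc (deg H v)        ≤⟨ s≤s (⊓-monoˡ-≤ (deg H v) (n≤1+n 2)) ⟩
      suc (3 ⊓ deg H v)        ≤⟨ s≤s (ψ-dynamic v) ⟩
      suc (seenColours H ψ v)  ≤⟨ seenColours-detach< G x vx (proj₂ (admissible (adj-sym G vx)) few) ⟩
      seenColours G φ v        ∎
      where open ≤-Reasoning

module _ {k} (G : Graph) (x : Fin (n G)) (L : ListAssignment G k) {ψ : Fin (n G) → ℕ} where

  extend-avoiding : DynamicLColouring (detach G x) (proj₁ L) ψ → (F : List ℕ) → length F < k →
                    (∀ {c y} → c ∉ F → adj G x y ≡ true → Admissible (detach G x) ψ y c) → DynamicAt G ψ x →
                    ∃ λ c → c ∉ F × DynamicLColouring G (proj₁ L) (ψ [ x ]≔ c)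
  extend-avoiding (ψ-dynamic , ψ∈L) F |F|<k admissible x-dynamic
    with c , c∈Lx , c∉F ← longer⇒∃∉ ℕ._≟_ (proj₁ (proj₂ L x)) (≤-trans |F|<k (proj₂ (proj₂ L x)))
    = c , c∉F , extend G x ψ-dynamic (admissible c∉F) x-dynamic , recolour-∈ ψ∈L c∈Lx

recolouring : ∀ (G : Graph) {L x ψ} {P : ℕ → Set} →
              (∃ λ c → P c × DynamicLColouring G L (ψ [ x ]≔ c)) → ∃ (DynamicLColouring G L)
recolouring _ (_ , _ , φ-ok) = _ , φ-ok

-- Deleting a vertex changes the vertex type, so the graph is given by its fields.
module VertexDeletion {m : ℕ} (a : Fin (suc m) → Fin (suc m) → Bool)
                      (a-sym : ∀ u v → a u v ≡ a v u) (a-irrefl : ∀ v → a v v ≡ false)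
                      (x : Fin (suc m)) where

  G : Graph
  G = record { n = suc m ; adj = a ; sym = a-sym ; irrefl = a-irrefl }

  G-x : Graph
  G-x = record
    { n      = m
    ; adj    = λ u v → a (punchIn x u) (punchIn x v)
    ; sym    = λ u v → a-sym (punchIn x u) (punchIn x v)
    ; irrefl = a-irrefl ∘ punchIn x
    }

  data View : Fin (suc m) → Set where
    at-x    : View x
    punched : ∀ u → View (punchIn x u)

  view : ∀ y → View y
  view y with x Fin.≟ y
  ... | yes refl = at-x
  ... | no x≢y = subst View (Finₚ.punchIn-punchOut x≢y) (punched (punchOut x≢y))

  size-G-x< : size G-x < size G
  size-G-x< = s≤s (+-monoʳ-≤ m (begin
    numEdges G-x                           ≡⟨ length-map punchIn² (edgePairs G-x) ⟨
    length (map punchIn² (edgePairs G-x))  ≤⟨ Unique-⊆⇒length≤ (Uniqueₚ.map⁺ punchIn²-injective (edgePairs-unique G-x))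
                                                                map⊆ ⟩
    numEdges G                             ∎))
    where
    open ≤-Reasoning
    punchIn² : Fin m × Fin m → Fin (suc m) × Fin (suc m)
    punchIn² (u , v) = punchIn x u , punchIn x v
    punchIn²-injective : ∀ {p q} → punchIn² p ≡ punchIn² q → p ≡ q
    punchIn²-injective {u , v} {u′ , v′} eq =
      cong₂ _,_ (Finₚ.punchIn-injective x u u′ (cong proj₁ eq)) (Finₚ.punchIn-injective x v v′ (cong proj₂ eq))
    map⊆ : map punchIn² (edgePairs G-x) ⊆ edgePairs G
    map⊆ p∈ with (u , v) , uv∈ , refl ← ∈-map⁻ punchIn² p∈ with u<v , uv ← ∈edgePairs⁻ G-x uv∈
      = ∈edgePairs⁺ G (≰⇒> λ v≤u → <⇒≱ u<v (Finₚ.punchIn-cancel-≤ x v u v≤u)) uv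

  module _ (iso : Isolated G x) (c₀ : ℕ) {ψ : Fin m → ℕ} where

    insertAt-proper : (∀ u v → adj G-x u v ≡ true → ψ u ≢ ψ v) →
                      ∀ u v → a u v ≡ true → insertAt ψ x c₀ u ≢ insertAt ψ x c₀ v
    insertAt-proper ψ-proper u v uv with view u | view v
    ... | at-x | _ = contradiction uv (iso v)
    ... | punched _ | at-x = contradiction (adj-sym G uv) (iso u)
    ... | punched u′ | punched v′ rewrite insertAt-punchIn ψ x c₀ u′ | insertAt-punchIn ψ x c₀ v′ = ψ-proper u′ v′ uv

    deg-punchIn≤ : ∀ u → deg G (punchIn x u) ≤ deg G-x u
    deg-punchIn≤ u = ≤-trans (deg≤length G (map (punchIn x) (nbrs G-x u)) nbr∈)
                             (≤-reflexive (length-map (punchIn x) (nbrs G-x u)))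
      where
      nbr∈ : ∀ {y} → a (punchIn x u) y ≡ true → y ∈ map (punchIn x) (nbrs G-x u)
      nbr∈ {y} uy with view y
      ... | at-x = contradiction (adj-sym G uy) (iso (punchIn x u))
      ... | punched y′ = ∈-map⁺ (punchIn x) (∈nbrs⁺ G-x uy)

    seen-punchIn⊆ : ∀ u → seen G-x ψ u ⊆ seen G (insertAt ψ x c₀) (punchIn x u)
    seen-punchIn⊆ u c∈ with y , uy , refl ← ∈seen⁻ G-x ψ c∈
      = subst (_∈ seen G (insertAt ψ x c₀) (punchIn x u)) (insertAt-punchIn ψ x c₀ y) (∈seen⁺ G (insertAt ψ x c₀) uy)

    insertAt-dynamic : Is3Dynamic G-x ψ → Is3Dynamic G (insertAt ψ x c₀)
    insertAt-dynamic (ψ-proper , ψ-dynamic) = insertAt-proper ψ-proper , dynamic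
      where
      dynamic : ∀ y → DynamicAt G (insertAt ψ x c₀) y
      dynamic y with view y
      ... | at-x = dynamicAt-isolated G iso
      ... | punched u = ≤-trans (⊓-monoʳ-≤ 3 (deg-punchIn≤ u))
                          (≤-trans (ψ-dynamic u) (Unique-⊆⇒length≤ (seen-unique G-x ψ u) (seen-punchIn⊆ u)))

  insertAt-∈ : ∀ {L : Fin (suc m) → List ℕ} {c₀ ψ} → c₀ ∈ L x → (∀ u → ψ u ∈ L (punchIn x u)) →
               ∀ y → insertAt ψ x c₀ y ∈ L y
  insertAt-∈ {L} {c₀} {ψ} c₀∈ ψ∈ y with view y
  ... | at-x = subst (_∈ L x) (≡.sym (insertAt-updates ψ x c₀)) c₀∈
  ... | punched u = subst (_∈ L (punchIn x u)) (≡.sym (insertAt-punchIn ψ x c₀ u)) (ψ∈ u)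

  choosable : ∀ {k} → 1 ≤ k → Isolated G x → Choosable3d G-x k → Choosable3d G k
  choosable 1≤k iso G-x-choosable (L , L!)
    with c₀ , c₀∈ , _ ← longer⇒∃∉ ℕ._≟_ {ys = []} (proj₁ (L! x)) (≤-trans 1≤k (proj₂ (L! x)))
    with ψ , ψ-dynamic , ψ∈ ← G-x-choosable (L ∘ punchIn x , L! ∘ punchIn x)
    = insertAt ψ x c₀ , insertAt-dynamic iso c₀ ψ-dynamic , insertAt-∈ c₀∈ ψ∈

isolated-reducible : ∀ {k} (G : Graph) {x} → 1 ≤ k → Isolated G x →
                     ((H : Graph) → size H < size G → Choosable3d H k) → Choosable3d G k
isolated-reducible record { n = zero } {()}
isolated-reducible record { n = suc m ; adj = a ; sym = a-sym ; irrefl = a-irrefl } {x} 1≤k iso minimal =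
  choosable 1≤k iso (minimal G-x size-G-x<)
  where open VertexDeletion a a-sym a-irrefl x

module _ (G : Graph) where

  Deg2Path : Fin (n G) → Fin (n G) → Fin (n G) → Set
  Deg2Path v w y = adj G v w ≡ true × deg G w ≡ 2 × adj G w y ≡ true

  weak-nbrs : ∀ v → (∀ {w₁ w₂ y} → Deg2Path v w₁ y → Deg2Path v w₂ y → y ≢ v → w₁ ≡ w₂) →
              Σ (Fin (num2Nbrs G v) → Fin (n G)) λ f → Injective _≡_ _≡_ f × (∀ j → WeakAdj G v (f j))
  weak-nbrs v unique-path = far , far-injective , far-weak
    where
    2-nbrs = filter (λ u → deg G u ℕ.≟ 2) (nbrs G v)
    near : Fin (num2Nbrs G v) → Fin (n G)
    near = lookup 2-nbrs
    near-2nbr : ∀ j → adj G v (near j) ≡ true × deg G (near j) ≡ 2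
    near-2nbr j with near∈ , near≡2 ← ∈-filter⁻ (λ u → deg G u ℕ.≟ 2) (∈-lookup j) = ∈nbrs⁻ G near∈ , near≡2
    far-spec : ∀ j → ∃ λ y → adj G (near j) y ≡ true × y ≢ v
    far-spec j = other-nbr-of-deg2 G v (proj₂ (near-2nbr j))
    far : Fin (num2Nbrs G v) → Fin (n G)
    far = proj₁ ∘ far-spec
    path : ∀ j → Deg2Path v (near j) (far j)
    path j = proj₁ (near-2nbr j) , proj₂ (near-2nbr j) , proj₁ (proj₂ (far-spec j))
    far-injective : Injective _≡_ _≡_ far
    far-injective {i} {j} far≡ = lookup-injective (Uniqueₚ.filter⁺ _ (nbrs-unique G v))
      (unique-path (path i) (subst (Deg2Path v (near j)) (≡.sym far≡) (path j)) (proj₂ (proj₂ (far-spec i))))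
    far-weak : ∀ j → WeakAdj G v (far j)
    far-weak j = proj₂ (proj₂ (far-spec j)) ∘ ≡.sym , near j , proj₁ (near-2nbr j) ,
                 adj-sym G (proj₁ (proj₂ (far-spec j))) , proj₂ (near-2nbr j)

module _ {k} (6≤k : 6 ≤ k) where

  private
    ≤5⇒<k : ∀ {m} → m ≤ 5 → m < k
    ≤5⇒<k m≤5 = ≤-trans (s≤s m≤5) 6≤k

  module _ (G : Graph) (x : Fin (n G)) (L : ListAssignment G k) {ψ : Fin (n G) → ℕ} where

    extend-deg≤1 : deg G x ≤ 1 → (E : List ℕ) → length E ≤ 2 → DynamicLColouring (detach G x) (proj₁ L) ψ →
                   ∃ λ c → c ∉ E × DynamicLColouring G (proj₁ L) (ψ [ x ]≔ c)
    extend-deg≤1 x≤1 E |E|≤2 ψ-ok with isolated⊎nbr G x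
    ... | inj₁ iso = extend-avoiding G x L ψ-ok E (≤5⇒<k (≤-trans |E|≤2 (s≤s (s≤s z≤n))))
                       (λ {_} {y} _ xy → contradiction xy (iso y)) (dynamicAt-isolated G iso)
    ... | inj₂ (y , xy) = drop-forbidden (extend-avoiding G x L ψ-ok (forbidden H ψ y ++ E)
                            (≤5⇒<k (length-++-≤ (forbidden H ψ y) (length-forbidden≤3 H ψ y) |E|≤2)) admissible
                            (dynamicAt-deg≤1 G x≤1 xy))
      where
      H = detach G x
      admissible : ∀ {c z} → c ∉ forbidden H ψ y ++ E → adj G x z ≡ true → Admissible H ψ z c
      admissible c∉ xz rewrite nbr-of-deg≤1 G x≤1 xy xz = ∉forbidden⇒admissible H ψ (c∉ ∘ ∈-++⁺ˡ)
      drop-forbidden : (∃ λ c → c ∉ forbidden H ψ y ++ E × DynamicLColouring G (proj₁ L) (ψ [ x ]≔ c)) →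
                       ∃ λ c → c ∉ E × DynamicLColouring G (proj₁ L) (ψ [ x ]≔ c)
      drop-forbidden (c , c∉ , φ-ok) = c , c∉ ∘ ∈-++⁺ʳ _ , φ-ok

    extend-deg≤2 : ∀ {v} → adj G x v ≡ true → deg G x ≤ 2 → deg (detach G x) v ≤ 1 →
                   (∀ {a} → adj G x a ≡ true → a ≢ v → ψ v ≢ ψ a) →
                   DynamicLColouring (detach G x) (proj₁ L) ψ → ∃ (DynamicLColouring G (proj₁ L))
    extend-deg≤2 {v} xv x≤2 v≤1 distinct ψ-ok with nbr-other-than G x v
    ... | inj₂ nbrs≡v = recolouring G (extend-deg≤1 (deg≤length G (v ∷ []) (here ∘ nbrs≡v)) [] z≤n ψ-ok)
    ... | inj₁ (a , xa , a≢v) = recolouring G (extend-avoiding G x L ψ-ok (forbidden H ψ v ++ forbidden H ψ a)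
                                  (≤5⇒<k (length-++-≤ (forbidden H ψ v)
                                            (≤-trans (length-forbidden≤1+deg H ψ v) (s≤s v≤1))
                                            (length-forbidden≤3 H ψ a)))
                                  admissible (dynamicAt-deg≤2 G x≤2 xv xa (distinct xa a≢v)))
      where
      H = detach G x
      admissible : ∀ {c z} → c ∉ forbidden H ψ v ++ forbidden H ψ a → adj G x z ≡ true → Admissible H ψ z c
      admissible c∉ xz with nbrs-of-deg≤2 G x≤2 xv xa (a≢v ∘ ≡.sym) xz
      ... | inj₁ refl = ∉forbidden⇒admissible H ψ (c∉ ∘ ∈-++⁺ˡ)
      ... | inj₂ refl = ∉forbidden⇒admissible H ψ (c∉ ∘ ∈-++⁺ʳ _)

  module MinimalCounterexample (G : Graph) (minimal : (H : Graph) → size H < size G → Choosable3d H k) where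

    deg≤1-reducible : ∀ {x} → deg G x ≤ 1 → Choosable3d G k
    deg≤1-reducible {x} x≤1 L with isolated⊎nbr G x
    ... | inj₁ iso = isolated-reducible G (≤-trans (s≤s z≤n) 6≤k) iso minimal L
    ... | inj₂ (y , xy) =
      recolouring G (extend-deg≤1 G x L x≤1 [] z≤n (proj₂ (minimal (detach G x) (size-detach< G x xy) L)))

    -- v is coloured avoiding the colours on N(u), so that u afterwards sees two distinct colours.
    adjacent-deg≤2-reducible : ∀ {u v} → adj G u v ≡ true → deg G u ≤ 2 → deg G v ≤ 2 → Choosable3d G k
    adjacent-deg≤2-reducible {u} {v} uv u≤2 v≤2 L = extend-deg≤2 G u L uv u≤2 v≤1 distinct (proj₂ (proj₂ φ-sol))
      where
      G₁ = detach G u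
      v≤1 : deg G₁ v ≤ 1
      v≤1 = ≤-pred (≤-trans (deg-detach< G u (adj-sym G uv)) v≤2)
      ψ-sol = minimal (detach G₁ v) (≤-<-trans (size-detach≤ G₁ v) (size-detach< G u uv)) L
      ψ = proj₁ ψ-sol
      ψ[N[u]] = map ψ (nbrs G u)
      φ-sol = extend-deg≤1 G₁ v L v≤1 ψ[N[u]] (≤-trans (≤-reflexive (length-map ψ (nbrs G u))) u≤2) (proj₂ ψ-sol)
      c = proj₁ φ-sol
      distinct : ∀ {a} → adj G u a ≡ true → a ≢ v → (ψ [ v ]≔ c) v ≢ (ψ [ v ]≔ c) a
      distinct {a} ua a≢v φv≡φa = proj₁ (proj₂ φ-sol)
        (subst (_∈ ψ[N[u]]) (trans (≡.sym (updateAt-minimal a v ψ a≢v)) (trans (≡.sym φv≡φa) (updateAt-updates v ψ)))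
               (∈-map⁺ ψ (∈nbrs⁺ G ua)))

    triangle-reducible : ∀ {u v w} → adj G u v ≡ true → adj G u w ≡ true → adj G v w ≡ true → deg G w ≡ 2 →
                         Choosable3d G k
    triangle-reducible {u} {v} {w} uv uw vw w≡2 L
      with ψ , ψ-ok ← minimal (detach G w) (size-detach< G w (adj-sym G uw)) L
      = recolouring G (extend-avoiding G w L ψ-ok (avoid H ψ u v ++ avoid H ψ v u)
                         (≤5⇒<k (≤-trans (length-++-≤ (avoid H ψ u v) (length-avoid≤2 H ψ u v)
                                                                       (length-avoid≤2 H ψ v u))
                                         (n≤1+n 4)))
                         admissible (dynamicAt-deg≤2 G (≤-reflexive w≡2) wu wv (proj₁ (proj₁ ψ-ok) u v uvH)))
      where
      H = detach G w
      wu = adj-sym G uw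
      wv = adj-sym G vw
      uvH : adj H u v ≡ true
      uvH = detach-adj⁺ G w uv (adj⇒≢ G uw) (adj⇒≢ G vw)
      admissible : ∀ {c z} → c ∉ avoid H ψ u v ++ avoid H ψ v u → adj G w z ≡ true → Admissible H ψ z c
      admissible c∉ wz with nbrs-of-deg≤2 G (≤-reflexive w≡2) wu wv (adj⇒≢ G uv) wz
      ... | inj₁ refl = ∉avoid⇒admissible H ψ uvH (c∉ ∘ ∈-++⁺ˡ) (c∉ ∘ ∈-++⁺ʳ _)
      ... | inj₂ refl = ∉avoid⇒admissible H ψ (adj-sym H uvH) (c∉ ∘ ∈-++⁺ʳ _) (c∉ ∘ ∈-++⁺ˡ)

    two-deg2-paths-reducible : ∀ {v w₁ w₂ y} → deg G v ≡ 3 → Deg2Path G v w₁ y → Deg2Path G v w₂ y →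
                               w₁ ≢ w₂ → y ≢ v → Choosable3d G k
    two-deg2-paths-reducible {v} {w₁} {w₂} {y} v≡3 (vw₁ , w₁≡2 , w₁y) (vw₂ , w₂≡2 , w₂y) w₁≢w₂ y≢v L
      with ψ , ψ-ok ← minimal (detach G w₁) (size-detach< G w₁ (adj-sym G vw₁)) L
      = recolouring G (extend-avoiding G w₁ L ψ-ok (forbidden H ψ v ++ forbidden-without H ψ y (ψ w₂))
                       (≤5⇒<k (length-++-≤ (forbidden H ψ v) (length-forbidden≤3 H ψ v)
                                           (length-forbidden-without≤2 H ψ (adj-sym H w₂yH))))
                       admissible (dynamicAt-deg≤2 G (≤-reflexive w₁≡2) (adj-sym G vw₁) w₁y ψv≢ψy))
      where
      H = detach G w₁
      w₂vH : adj H w₂ v ≡ true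
      w₂vH = detach-adj⁺ G w₁ (adj-sym G vw₂) (w₁≢w₂ ∘ ≡.sym) (adj⇒≢ G vw₁)
      w₂yH : adj H w₂ y ≡ true
      w₂yH = detach-adj⁺ G w₁ w₂y (w₁≢w₂ ∘ ≡.sym) (adj⇒≢ G w₁y ∘ ≡.sym)
      ψv≢ψy : ψ v ≢ ψ y
      ψv≢ψy = dynamicAt⇒nbrs-distinct H (proj₂ (proj₁ ψ-ok) w₂) (≤-trans (deg-detach≤ G w₁) (≤-reflexive w₂≡2))
                w₂vH w₂yH (y≢v ∘ ≡.sym)
      v-few : seenColours H ψ v ≤ 2
      v-few = ≤-trans (seenColours≤deg H ψ v) (≤-pred (≤-trans (deg-detach< G w₁ vw₁) (≤-reflexive v≡3)))
      -- ψ w₂ is already forbidden at v, so it may be dropped from the list at y.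
      admissible : ∀ {c z} → c ∉ forbidden H ψ v ++ forbidden-without H ψ y (ψ w₂) → adj G w₁ z ≡ true →
                   Admissible H ψ z c
      admissible c∉ w₁z with nbrs-of-deg≤2 G (≤-reflexive w₁≡2) (adj-sym G vw₁) w₁y (y≢v ∘ ≡.sym) w₁z
      ... | inj₁ refl = ∉forbidden⇒admissible H ψ (c∉ ∘ ∈-++⁺ˡ)
      ... | inj₂ refl = ∉forbidden⇒admissible H ψ (∉forbidden-without H ψ (c∉ ∘ ∈-++⁺ʳ _)
                          λ { refl → c∉ (∈-++⁺ˡ (∈forbidden⁺ H ψ v-few (adj-sym H w₂vH))) })

lemma2p1 : (k : ℕ) → 6 ≤ k → (G : Graph) → ¬ Choosable3d G k →
    ((H : Graph) → size H < size G → Choosable3d H k) →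
    ((v : Fin (n G)) → 2 ≤ deg G v)
    × ((u v : Fin (n G)) → adj G u v ≡ true → deg G u ≤ 2 → deg G v ≤ 2 → ⊥)
    × ((u v w : Fin (n G)) → adj G u v ≡ true → adj G u w ≡ true → adj G v w ≡ true → deg G w ≡ 2 → ⊥)
    × ((i : ℕ) → 1 ≤ i → i ≤ 3 → (v : Fin (n G)) → InW G i v →
        Σ (Fin i → Fin (n G)) λ f → Injective _≡_ _≡_ f × ((j : Fin i) → WeakAdj G v (f j)))
lemma2p1 k 6≤k G ¬choosable minimal =
    (λ v → decidable-stable (2 ≤? deg G v) (¬choosable ∘ deg≤1-reducible ∘ ≤-pred ∘ ≰⇒>))
  , (λ u v uv u≤2 v≤2 → ¬choosable (adjacent-deg≤2-reducible uv u≤2 v≤2))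
  , (λ u v w uv uw vw w≡2 → ¬choosable (triangle-reducible uv uw vw w≡2))
  , λ { _ _ _ v (v≡3 , refl) → weak-nbrs G v λ p₁ p₂ y≢v →
          decidable-stable (_ Fin.≟ _) λ w₁≢w₂ → ¬choosable (two-deg2-paths-reducible v≡3 p₁ p₂ w₁≢w₂ y≢v) }
  where open MinimalCounterexample 6≤k G minimal
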